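{- Let $F_e\subseteq E(BS_3)$ with $|F_e|\le 4$. If $BS_3-F_e$ is disconnected, then $BS_3-F_e$ has exactly two components, one of which is an isolated vertex or a single edge.
   Context: The $n$-dimensional bubble-sort star graph $BS_n$ has as vertex set all permutations $x=x_1x_2\cdots x_n$ of $\{1,\dots,n\}$. Two distinct vertices $x,y$ are adjacent iff there is $k\in\{2,\dots,n\}$ such that $y$ is obtained from $x$ either by swapping the entries in positions $k-1$ and $k$, or by swapping the entries in positions $1$ and $k$. For $F_e\subseteq E(G)$, $G-F_e$ is the graph with vertex set $V(G)$ and edge set $E(G)\setminus F_e$. -}

module Defs where

open import Data.Nat using (ℕ; zero; suc)
open import Data.Fin using (Fin; zero; suc; inject₁)
open import Data.Vec using (Vec; lookup; _[_]≔_)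
open import Data.Vec.Membership.Propositional using () renaming (_∈_ to _∈ᵥ_)
open import Data.List using (List)
open import Data.List.Membership.Propositional using (_∈_)
open import Data.Product using (Σ; _×_; _,_; ∃)
open import Data.Sum using (_⊎_)
open import Data.Empty using (⊥)
open import Relation.Nullary using (¬_)
open import Relation.Binary.PropositionalEquality using (_≡_; _≢_)
open import Relation.Binary.Construct.Closure.ReflexiveTransitive using (Star)

-- A word x = x₁x₂⋯xₙ over {1,…,n} (encoded as Fin n, 0-based; positions 0-based).
Word : ℕ → Set
Word n = Vec (Fin n) n

-- x is a permutation of {1,…,n}: every symbol occurs in x (n symbols in n slots).
IsPerm : ∀ {n} → Word n → Set
IsPerm {n} x = (i : Fin n) → i ∈ᵥ x

swap : ∀ {n} → Fin n → Fin n → Word n → Word n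
swap i j x = (x [ i ]≔ lookup x j) [ j ]≔ lookup x i

-- Adjacency of BS_n.  For n = suc m, k : Fin m encodes the (1-based) index k+2 ∈ {2,…,n};
-- positions (k-1,k) are (inject₁ k, suc k) 0-based, and positions (1,k) are (zero, suc k).
BSAdj : ∀ {n} → Word n → Word n → Set
BSAdj {zero}  x y = ⊥
BSAdj {suc m} x y =
  x ≢ y × ∃ λ (k : Fin m) → (y ≡ swap (inject₁ k) (suc k) x) ⊎ (y ≡ swap zero (suc k) x)

-- A finite set of edges, given as a list of ordered pairs (each pair represents the edge {x,y}).
EdgeList : ℕ → Set
EdgeList n = List (Word n × Word n)

EdgesOf : ∀ {n} → EdgeList n → Set
EdgesOf {n} F = ∀ {x y} → (x , y) ∈ F → IsPerm x × IsPerm y × BSAdj x y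

Removed : ∀ {n} → EdgeList n → Word n → Word n → Set
Removed F x y = ((x , y) ∈ F) ⊎ ((y , x) ∈ F)

AdjMinus : ∀ {n} → EdgeList n → Word n → Word n → Set
AdjMinus F x y = BSAdj x y × ¬ Removed F x y

Reach : ∀ {n} → EdgeList n → Word n → Word n → Set
Reach F = Star (AdjMinus F)

Disconnected : ∀ {n} → EdgeList n → Set
Disconnected {n} F = Σ (Word n) λ x → Σ (Word n) λ y → IsPerm x × IsPerm y × ¬ Reach F x y

SmallComponent : ∀ {n} → EdgeList n → Word n → Set
SmallComponent {n} F v =
  ((u : Word n) → IsPerm u → Reach F v u → u ≡ v)
  ⊎ Σ (Word n) λ w → IsPerm w × AdjMinus F v w ×
      ((u : Word n) → IsPerm u → Reach F v u → (u ≡ v) ⊎ (u ≡ w))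

TwoComponentsOneSmall : ∀ {n} → EdgeList n → Set
TwoComponentsOneSmall {n} F =
  Σ (Word n) λ v → IsPerm v × SmallComponent F v
    × (Σ (Word n) λ u → IsPerm u × ¬ Reach F v u)
    × ((u u′ : Word n) → IsPerm u → IsPerm u′ → ¬ Reach F v u → ¬ Reach F v u′ → Reach F u u′)

-- BS₃ is the complete bipartite graph K₃,₃: the generators of BS₃ are all three
-- transpositions of S₃, so each even permutation is adjacent to each odd one. Removing
-- the edges listed in F therefore amounts to deleting a set S of at most |F| ≤ 4 of the
-- nine edges of K₃,₃, and the claim for K₃,₃ − S is verified for all 2⁹ subsets S by
-- computing connected components. A component is computed by growing {i} through
-- neighbourhoods n times; every round that does not reach a set closed under adjacency
-- adds a vertex, so after n rounds the set is closed, hence it is exactly the set of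
-- vertices reachable from i.
module Submission where

open import Defs
open import Level using (0ℓ)
open import Data.Bool using (Bool; true; false)
open import Data.Bool.Properties using (T-≡)
open import Data.Empty using (⊥-elim)
open import Data.Fin using (Fin; zero; suc; _≟_; #_; inject₁; splitAt; combine; remQuot; _↑ˡ_; _↑ʳ_)
open import Data.Fin.Properties using (all?; any?)
open import Data.Fin.Subset using (Subset; _∈_; _∉_; _⊆_; _∪_; ⁅_⁆; ⊥; ∣_∣; inside; outside)
open import Data.Fin.Subset.Properties
  using ( _∈?_; p⊆p∪q; q⊆p∪q; x∈p∪q⁻; x∈p∪q⁺; p⊂q⇒∣p∣<∣q∣; ∣p∣≤n; ∣⁅x⁆∣≡1; x∈⁅x⁆; x∈⁅y⁆⇒x≡y
        ; ∉⊥)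
open import Data.List using ([]; _∷_; length)
open import Data.List.Relation.Unary.Any using (here; there)
open import Data.Maybe using (Maybe; just; nothing)
import Data.Maybe.Properties as Maybe
open import Data.Nat using (ℕ; zero; suc; _+_; _≤_; _<_; _≤?_; z≤n; s≤s)
open import Data.Nat.Properties
  using (≤-reflexive; ≤-trans; +-identityʳ; +-suc; n≤1+n; +-monoʳ-≤; +-mono-≤; <⇒≱)
open import Data.Product using (_×_; _,_; ∃; proj₁; proj₂; uncurry)
import Data.Product as Product
import Data.Product.Properties as Product
open import Data.Sum using (_⊎_; inj₁; inj₂)
import Data.Sum as Sum
open import Data.Vec using (Vec; []; _∷_; lookup; tabulate)
import Data.Vec.Properties as Vec
import Data.Vec.Membership.DecPropositional as VecMembership
open import Function using (_∘_; _⇔_; mk⇔; Equivalence)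
open import Relation.Binary using (Rel; DecidableEquality)
import Relation.Binary as B
open import Relation.Binary.Construct.Closure.ReflexiveTransitive using (Star; ε; _◅_; _◅◅_; gmap)
open import Relation.Binary.PropositionalEquality using (_≡_; _≢_; refl; sym; trans; cong; subst)
open import Relation.Nullary using (¬_; Dec; yes; no; contradiction)
open import Relation.Nullary.Decidable
  using (isYes; toWitness; fromWitness; from-yes; decidable-stable; map′; ¬?; _×-dec_; _⊎-dec_; _→-dec_)
import Relation.Unary as U

AllDecidable : Set → Set₁
AllDecidable A = ∀ {P : A → Set} → U.Decidable P → Dec (∀ a → P a)

∀-Bool? : AllDecidable Bool
∀-Bool? P? = map′ (λ { (t , f) true → t ; (t , f) false → f }) (λ g → g true , g false)
                  (P? true ×-dec P? false)

∀-Vec? : ∀ {A} → AllDecidable A → ∀ {n} → AllDecidable (Vec A n)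
∀-Vec? ∀? {zero}  P? = map′ (λ { p [] → p }) (λ g → g []) (P? [])
∀-Vec? ∀? {suc n} P? = map′ (λ g → λ { (a ∷ v) → g a v }) (λ g a v → g (a ∷ v))
                            (∀? λ a → ∀-Vec? ∀? λ v → P? (a ∷ v))

∣p∪q∣≤∣p∣+∣q∣ : ∀ {n} (p q : Subset n) → ∣ p ∪ q ∣ ≤ ∣ p ∣ + ∣ q ∣
∣p∪q∣≤∣p∣+∣q∣ []            []            = z≤n
∣p∪q∣≤∣p∣+∣q∣ (outside ∷ p) (outside ∷ q) = ∣p∪q∣≤∣p∣+∣q∣ p q
∣p∪q∣≤∣p∣+∣q∣ (inside  ∷ p) (outside ∷ q) = s≤s (∣p∪q∣≤∣p∣+∣q∣ p q)
∣p∪q∣≤∣p∣+∣q∣ (outside ∷ p) (inside  ∷ q) =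
  subst (suc ∣ p ∪ q ∣ ≤_) (sym (+-suc ∣ p ∣ ∣ q ∣)) (s≤s (∣p∪q∣≤∣p∣+∣q∣ p q))
∣p∪q∣≤∣p∣+∣q∣ (inside  ∷ p) (inside  ∷ q) =
  s≤s (≤-trans (∣p∪q∣≤∣p∣+∣q∣ p q) (+-monoʳ-≤ ∣ p ∣ (n≤1+n ∣ q ∣)))

module _ {n : ℕ} (R : Rel (Fin n) 0ℓ) where

  Connected : Set
  Connected = ∀ i j → Star R i j

  SmallComponentᴿ : Fin n → Set
  SmallComponentᴿ v =
    (∀ u → Star R v u → u ≡ v) ⊎ ∃ λ w → R v w × (∀ u → Star R v u → u ≡ v ⊎ u ≡ w)

  TwoComponentsOneSmallᴿ : Set
  TwoComponentsOneSmallᴿ = ∃ λ v → SmallComponentᴿ v × (∃ λ u → ¬ Star R v u)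
    × (∀ u u′ → ¬ Star R v u → ¬ Star R v u′ → Star R u u′)

module Reachability {n : ℕ} {R : Rel (Fin n) 0ℓ} (R? : B.Decidable R) where

  successors : Subset n → Subset n
  successors C = tabulate λ j → isYes (any? λ i → i ∈? C ×-dec R? i j)

  grow : Subset n → Subset n
  grow C = C ∪ successors C

  grow^ : ℕ → Subset n → Subset n
  grow^ zero    C = C
  grow^ (suc k) C = grow (grow^ k C)

  component : Fin n → Subset n
  component i = grow^ n ⁅ i ⁆

  ∈-successors⁻ : ∀ {C j} → j ∈ successors C → ∃ λ i → i ∈ C × R i j
  ∈-successors⁻ {C} {j} j∈ =
    toWitness (Equivalence.from T-≡ (trans (sym (Vec.lookup∘tabulate _ j)) (Vec.[]=⇒lookup j∈)))

  ∈-successors⁺ : ∀ {C i j} → i ∈ C → R i j → j ∈ successors C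
  ∈-successors⁺ {C} {i} {j} i∈C r = Vec.lookup⇒[]= j _
    (trans (Vec.lookup∘tabulate _ j) (Equivalence.to T-≡ (fromWitness (i , i∈C , r))))

  ∈-grow⁻ : ∀ {C j} → j ∈ grow C → j ∈ C ⊎ ∃ λ i → i ∈ C × R i j
  ∈-grow⁻ {C} j∈ = Sum.map₂ ∈-successors⁻ (x∈p∪q⁻ C (successors C) j∈)

  Reaches : Fin n → Subset n → Set
  Reaches i C = ∀ {j} → j ∈ C → Star R i j

  grow-reaches : ∀ {i C} → Reaches i C → Reaches i (grow C)
  grow-reaches reaches j∈ with ∈-grow⁻ j∈
  ... | inj₁ j∈C           = reaches j∈C
  ... | inj₂ (l , l∈C , r) = reaches l∈C ◅◅ (r ◅ ε)

  grow^-reaches : ∀ k {i C} → Reaches i C → Reaches i (grow^ k C)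
  grow^-reaches zero    reaches = reaches
  grow^-reaches (suc k) reaches = grow-reaches (grow^-reaches k reaches)

  component-sound : ∀ {i j} → j ∈ component i → Star R i j
  component-sound {i} = grow^-reaches n λ j∈ → subst (Star R i) (sym (x∈⁅y⁆⇒x≡y i j∈)) ε

  Closed : Subset n → Set
  Closed C = ∀ {i j} → i ∈ C → R i j → j ∈ C

  closed-star : ∀ {C i j} → Closed C → i ∈ C → Star R i j → j ∈ C
  closed-star closed i∈C ε        = i∈C
  closed-star closed i∈C (r ◅ rs) = closed-star closed (closed i∈C r) rs

  grow-closed : ∀ {C} → Closed C → Closed (grow C)
  grow-closed {C} closed i∈ r = p⊆p∪q (successors C) (closed (grow⊆ i∈) r)
    where
    grow⊆ : grow C ⊆ C
    grow⊆ j∈ with ∈-grow⁻ j∈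
    ... | inj₁ j∈C           = j∈C
    ... | inj₂ (i , i∈C , r) = closed i∈C r

  closed⊎grows : ∀ C → Closed C ⊎ ∣ C ∣ < ∣ grow C ∣
  closed⊎grows C with any? (λ j → j ∈? successors C ×-dec ¬? (j ∈? C))
  ... | yes (j , j∈s , j∉C) = inj₂ (p⊂q⇒∣p∣<∣q∣ (p⊆p∪q _ , j , q⊆p∪q C _ j∈s , j∉C))
  ... | no  ¬new            = inj₁ λ {i} {j} i∈C r →
    decidable-stable (j ∈? C) λ j∉C → ¬new (j , ∈-successors⁺ i∈C r , j∉C)

  closed⊎large : ∀ k C → Closed (grow^ k C) ⊎ ∣ C ∣ + k ≤ ∣ grow^ k C ∣
  closed⊎large zero    C = inj₂ (≤-reflexive (+-identityʳ ∣ C ∣))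
  closed⊎large (suc k) C with closed⊎large k C
  ... | inj₁ closed = inj₁ (grow-closed closed)
  ... | inj₂ large with closed⊎grows (grow^ k C)
  ...   | inj₁ closed = inj₁ (grow-closed closed)
  ...   | inj₂ grows  =
    inj₂ (subst (_≤ ∣ grow^ (suc k) C ∣) (sym (+-suc ∣ C ∣ k)) (≤-trans (s≤s large) grows))

  component-closed : ∀ i → Closed (component i)
  component-closed i with closed⊎large n ⁅ i ⁆
  ... | inj₁ closed = closed
  ... | inj₂ large  = contradiction (∣p∣≤n (component i))
    (<⇒≱ (subst (λ m → m + n ≤ ∣ component i ∣) (∣⁅x⁆∣≡1 i) large))

  component-complete : ∀ {i j} → Star R i j → j ∈ component i
  component-complete {i} = closed-star (component-closed i) (grow^-⊇ n (x∈⁅x⁆ i))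
    where
    grow^-⊇ : ∀ k {C} → C ⊆ grow^ k C
    grow^-⊇ zero    i∈ = i∈
    grow^-⊇ (suc k) i∈ = p⊆p∪q _ (grow^-⊇ k i∈)

  -- The components are tabulated once and passed around, so that evaluating a decision
  -- does not recompute them at every query.
  private
    module Decisions (table : Vec (Subset n) n) (table≗component : ∀ i → lookup table i ≡ component i) where
      star? : ∀ i j → Dec (Star R i j)
      star? i j = map′ (λ j∈ → component-sound (subst (j ∈_) (table≗component i) j∈))
                       (λ s → subst (j ∈_) (sym (table≗component i)) (component-complete s))
                       (j ∈? lookup table i)

      connected? : Dec (Connected R)
      connected? = all? λ i → all? λ j → star? i j

      twoComponentsOneSmall? : Dec (TwoComponentsOneSmallᴿ R)
      twoComponentsOneSmall? = any? λ v →
        (   (all? λ u → star? v u →-dec u ≟ v)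
        ⊎-dec any? λ w → R? v w ×-dec all? λ u → star? v u →-dec (u ≟ v ⊎-dec u ≟ w))
        ×-dec any? (λ u → ¬? (star? v u))
        ×-dec all? λ u → all? λ u′ → ¬? (star? v u) →-dec ¬? (star? v u′) →-dec star? u u′

  open Decisions (tabulate component) (Vec.lookup∘tabulate component) public

_≟ʷ_ : ∀ {n} → DecidableEquality (Word n)
_≟ʷ_ {n} = Vec.≡-dec (_≟_ {n})

isPerm? : ∀ {n} (x : Word n) → Dec (IsPerm x)
isPerm? {n} x = all? λ s → VecMembership._∈?_ (_≟_ {n}) s x

BSAdj? : ∀ {n} (x y : Word n) → Dec (BSAdj x y)
BSAdj? {zero}  x y = no λ ()
BSAdj? {suc m} x y =
  ¬? (x ≟ʷ y) ×-dec any? λ k → y ≟ʷ swap (inject₁ k) (suc k) x ⊎-dec y ≟ʷ swap zero (suc k) x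

-- K₃,₃ with vertices 0, 1, 2 the even and 3, 4, 5 the odd permutations; the edge
-- combine a b joins a to 3 + b.

word : Fin 6 → Word 3
word = lookup ((# 0 ∷ # 1 ∷ # 2 ∷ []) ∷ (# 1 ∷ # 2 ∷ # 0 ∷ []) ∷ (# 2 ∷ # 0 ∷ # 1 ∷ [])
             ∷ (# 0 ∷ # 2 ∷ # 1 ∷ []) ∷ (# 1 ∷ # 0 ∷ # 2 ∷ []) ∷ (# 2 ∷ # 1 ∷ # 0 ∷ []) ∷ [])

ends : Fin 9 → Fin 6 × Fin 6
ends e = Product.map (_↑ˡ 3) (3 ↑ʳ_) (remQuot {3} 3 e)

edgeBetween : Fin 6 → Fin 6 → Maybe (Fin 9)
edgeBetween i j with splitAt 3 i | splitAt 3 j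
... | inj₁ a | inj₂ b = just (combine a b)
... | inj₂ b | inj₁ a = just (combine a b)
... | _      | _      = nothing

-- The facts proved by evaluating a decision are opaque, so that the type checker never
-- unfolds them again where they are used.

opaque
  word-injective : ∀ i j → word i ≡ word j → i ≡ j
  word-injective = from-yes (all? λ i → all? λ j → word i ≟ʷ word j →-dec i ≟ j)

opaque
  word-isPerm : ∀ i → IsPerm (word i)
  word-isPerm = from-yes (all? λ i → isPerm? (word i))

opaque
  isPerm⇒word : (x : Word 3) → IsPerm x → ∃ λ i → x ≡ word i
  isPerm⇒word = from-yes (∀-Vec? all? λ x → isPerm? x →-dec any? λ i → x ≟ʷ word i)

opaque
  BSAdj-word : ∀ i (y : Word 3) → BSAdj (word i) y → ∃ λ j → y ≡ word j
  BSAdj-word = from-yes (all? λ i → ∀-Vec? all? λ y →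
    BSAdj? (word i) y →-dec any? λ j → y ≟ʷ word j)

opaque
  BSAdj-word⇒edge : ∀ i j → BSAdj (word i) (word j) → ∃ λ e → edgeBetween i j ≡ just e
  BSAdj-word⇒edge = from-yes (all? λ i → all? λ j →
    BSAdj? (word i) (word j) →-dec any? λ e → Maybe.≡-dec _≟_ (edgeBetween i j) (just e))

opaque
  edge⇒BSAdj-word : ∀ i j e → edgeBetween i j ≡ just e
                    → BSAdj (word i) (word j) × (ends e ≡ (i , j) ⊎ ends e ≡ (j , i))
  edge⇒BSAdj-word = from-yes (all? λ i → all? λ j → all? λ e →
    Maybe.≡-dec _≟_ (edgeBetween i j) (just e) →-dec
    BSAdj? (word i) (word j) ×-dec (ends e ≟ᵉ (i , j) ⊎-dec ends e ≟ᵉ (j , i)))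
    where
    _≟ᵉ_ : DecidableEquality (Fin 6 × Fin 6)
    _≟ᵉ_ = Product.≡-dec _≟_ _≟_

record Link (S : Subset 9) (i j : Fin 6) : Set where
  constructor link
  field
    edge    : Fin 9
    between : edgeBetween i j ≡ just edge
    kept    : edge ∉ S

link? : ∀ S i j → Dec (Link S i j)
link? S i j with edgeBetween i j in between
... | nothing = no λ { (link _ between′ _) → nothing≢just (trans (sym between) between′) }
  where
  nothing≢just : ∀ {e} → nothing ≢ just e
  nothing≢just ()
... | just e  = map′ (link e between) kept-e (¬? (e ∈? S))
  where
  kept-e : Link S i j → e ∉ S
  kept-e (link e′ between′ kept) =
    subst (_∉ S) (Maybe.just-injective (trans (sym between′) between)) kept

opaque
  K₃₃-cut : ∀ S → ∣ S ∣ ≤ 4 → Connected (Link S) ⊎ TwoComponentsOneSmallᴿ (Link S)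
  K₃₃-cut = from-yes (∀-Vec? ∀-Bool? λ S → ∣ S ∣ ≤? 4 →-dec
    (Reachability.connected? (link? S) ⊎-dec Reachability.twoComponentsOneSmall? (link? S)))

endWords : Fin 9 → Word 3 × Word 3
endWords e = Product.map word word (ends e)

Matches : Word 3 × Word 3 → Fin 9 → Set
Matches p e = endWords e ≡ p ⊎ Product.swap (endWords e) ≡ p

matches? : ∀ p e → Dec (Matches p e)
matches? p e = endWords e ≟ᵖ p ⊎-dec Product.swap (endWords e) ≟ᵖ p
  where
  _≟ᵖ_ : DecidableEquality (Word 3 × Word 3)
  _≟ᵖ_ = Product.≡-dec _≟ʷ_ _≟ʷ_

matches-swap : ∀ {p e} → Matches p e → Matches (Product.swap p) e
matches-swap = Sum.swap ∘ Sum.map (cong Product.swap) (cong Product.swap)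

opaque
  endWords-unique : ∀ e e′ → Matches (endWords e) e′ → e′ ≡ e
  endWords-unique = from-yes (all? λ e → all? λ e′ → matches? (endWords e) e′ →-dec e′ ≟ e)

matches-unique : ∀ {p e e′} → Matches p e → Matches p e′ → e ≡ e′
matches-unique {e = e} {e′} (inj₁ refl) m′ = sym (endWords-unique e e′ m′)
matches-unique {e = e} {e′} (inj₂ refl) m′ =
  sym (endWords-unique e e′ (matches-swap {Product.swap (endWords e)} {e′} m′))

edgeOf : Word 3 × Word 3 → Subset 9
edgeOf p with any? (matches? p)
... | yes (e , _) = ⁅ e ⁆
... | no _        = ⊥

∣edgeOf∣≤1 : ∀ p → ∣ edgeOf p ∣ ≤ 1
∣edgeOf∣≤1 p with any? (matches? p)
... | yes (e , _) = ≤-reflexive (∣⁅x⁆∣≡1 e)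
... | no _        = z≤n

∈-edgeOf⁻ : ∀ {p e} → e ∈ edgeOf p → Matches p e
∈-edgeOf⁻ {p} {e} e∈ with any? (matches? p)
... | yes (e′ , m) = subst (Matches p) (sym (x∈⁅y⁆⇒x≡y e′ e∈)) m
... | no _         = contradiction e∈ ∉⊥

∈-edgeOf⁺ : ∀ {p e} → Matches p e → e ∈ edgeOf p
∈-edgeOf⁺ {p} {e} m with any? (matches? p)
... | yes (e′ , m′) = subst (_∈ ⁅ e′ ⁆) (matches-unique m′ m) (x∈⁅x⁆ e′)
... | no ¬match     = contradiction (e , m) ¬match

removedEdges : EdgeList 3 → Subset 9
removedEdges []      = ⊥
removedEdges (p ∷ F) = edgeOf p ∪ removedEdges F

∣removedEdges∣≤length : ∀ F → ∣ removedEdges F ∣ ≤ length F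
∣removedEdges∣≤length []      = z≤n
∣removedEdges∣≤length (p ∷ F) = ≤-trans (∣p∪q∣≤∣p∣+∣q∣ (edgeOf p) (removedEdges F))
                                        (+-mono-≤ (∣edgeOf∣≤1 p) (∣removedEdges∣≤length F))

∈-removedEdges⁻ : ∀ F {e} → e ∈ removedEdges F → uncurry (Removed F) (endWords e)
∈-removedEdges⁻ []      e∈ = contradiction e∈ ∉⊥
∈-removedEdges⁻ (p ∷ F) e∈ with x∈p∪q⁻ (edgeOf p) (removedEdges F) e∈
... | inj₁ e∈p = Sum.map here here (∈-edgeOf⁻ e∈p)
... | inj₂ e∈F = Sum.map there there (∈-removedEdges⁻ F e∈F)

∈-removedEdges⁺ : ∀ F {e} → uncurry (Removed F) (endWords e) → e ∈ removedEdges F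
∈-removedEdges⁺ (p ∷ F) (inj₁ (here eq))  = x∈p∪q⁺ (inj₁ (∈-edgeOf⁺ (inj₁ eq)))
∈-removedEdges⁺ (p ∷ F) (inj₂ (here eq))  = x∈p∪q⁺ (inj₁ (∈-edgeOf⁺ (inj₂ eq)))
∈-removedEdges⁺ (p ∷ F) (inj₁ (there m)) = x∈p∪q⁺ (inj₂ (∈-removedEdges⁺ F (inj₁ m)))
∈-removedEdges⁺ (p ∷ F) (inj₂ (there m)) = x∈p∪q⁺ (inj₂ (∈-removedEdges⁺ F (inj₂ m)))

module _ (F : EdgeList 3) where

  Removed-ends : ∀ i j e → ends e ≡ (i , j) ⊎ ends e ≡ (j , i)
                 → uncurry (Removed F) (endWords e) ⇔ Removed F (word i) (word j)
  Removed-ends i j e (inj₁ refl) = mk⇔ (λ r → r) (λ r → r)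
  Removed-ends i j e (inj₂ refl) = mk⇔ Sum.swap Sum.swap

  adjMinus⇒link : ∀ i j → AdjMinus F (word i) (word j) → Link (removedEdges F) i j
  adjMinus⇒link i j (adj , unremoved) with BSAdj-word⇒edge i j adj
  ... | e , edge = link e edge λ e∈ → unremoved
    (Equivalence.to (Removed-ends i j e (proj₂ (edge⇒BSAdj-word i j e edge))) (∈-removedEdges⁻ F e∈))

  link⇒adjMinus : ∀ {i j} → Link (removedEdges F) i j → AdjMinus F (word i) (word j)
  link⇒adjMinus {i} {j} (link e edge e∉) with edge⇒BSAdj-word i j e edge
  ... | adj , ends≡ = adj , λ removed →
    e∉ (∈-removedEdges⁺ F (Equivalence.from (Removed-ends i j e ends≡) removed))

  star⇒reach : ∀ {i j} → Star (Link (removedEdges F)) i j → Reach F (word i) (word j)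
  star⇒reach = gmap word link⇒adjMinus

  reach⇒star : ∀ {i u} → Reach F (word i) u
               → ∃ λ j → u ≡ word j × Star (Link (removedEdges F)) i j
  reach⇒star {i} ε = i , refl , ε
  reach⇒star {i} (adj ◅ rest) with BSAdj-word i _ (proj₁ adj)
  ... | j , refl with reach⇒star rest
  ...   | k , u≡ , path = k , u≡ , adjMinus⇒link i j adj ◅ path

  reach-word⇒star : ∀ {i j} → Reach F (word i) (word j) → Star (Link (removedEdges F)) i j
  reach-word⇒star {i} {j} r with reach⇒star r
  ... | k , eq , path = subst (Star (Link (removedEdges F)) i) (sym (word-injective j k eq)) path

  smallComponent-transfer : ∀ {v} → SmallComponentᴿ (Link (removedEdges F)) v
                            → SmallComponent F (word v)
  smallComponent-transfer {v} (inj₁ only-v) = inj₁ λ _ _ r → only-word r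
    where
    only-word : ∀ {u} → Reach F (word v) u → u ≡ word v
    only-word r with reach⇒star r
    ... | j , refl , path = cong word (only-v j path)
  smallComponent-transfer {v} (inj₂ (w , v~w , only-vw)) =
    inj₂ (word w , word-isPerm w , link⇒adjMinus v~w , λ _ _ r → only-words r)
    where
    only-words : ∀ {u} → Reach F (word v) u → u ≡ word v ⊎ u ≡ word w
    only-words r with reach⇒star r
    ... | j , refl , path = Sum.map (cong word) (cong word) (only-vw j path)

  twoComponents-transfer : TwoComponentsOneSmallᴿ (Link (removedEdges F)) → TwoComponentsOneSmall F
  twoComponents-transfer (v , small , (u , v↛u) , rest) =
    word v , word-isPerm v , smallComponent-transfer small ,
    (word u , word-isPerm u , v↛u ∘ reach-word⇒star) , others
    where
    others : ∀ x y → IsPerm x → IsPerm y → ¬ Reach F (word v) x → ¬ Reach F (word v) y → Reach F x y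
    others x y px py v↛x v↛y with isPerm⇒word x px | isPerm⇒word y py
    ... | a , refl | b , refl = star⇒reach (rest a b (v↛x ∘ star⇒reach) (v↛y ∘ star⇒reach))

lemma2p5 : (F : EdgeList 3) → EdgesOf F → length F ≤ 4
           → Disconnected F → TwoComponentsOneSmall F
lemma2p5 F _ len (x , y , px , py , x↛y) with isPerm⇒word x px | isPerm⇒word y py
... | i , refl | j , refl with K₃₃-cut (removedEdges F) (≤-trans (∣removedEdges∣≤length F) len)
...   | inj₁ connected = ⊥-elim (x↛y (star⇒reach F (connected i j)))
...   | inj₂ split     = twoComponents-transfer F split
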